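{- Let $\mathfrak{L}$ be a modal logic with a truth-preserving pair of translations $(\mathsf{Tf}_x,\mathsf{T})$, and let $\mathcal{M}$ be an $\omega$-saturated $\mathfrak{L}$-model with domain $W$ and a binary accessibility relation $R$ such that the first-order model of $\mathsf{T}(\mathcal{M},\cdot)$ has domain $W$ and interprets a binary relation symbol $R$ as $R$. Let $\Sigma$ be a set of $\mathfrak{L}$-formulas and $w\in W$. If for every finite $\Delta\subseteq\Sigma$ there is an $R$-successor $v_\Delta$ of $w$ with $\mathcal{M},v_\Delta\models\Delta$, then there is an $R$-successor $v$ of $w$ with $\mathcal{M},v\models\Sigma$.
   Context: $\mathfrak{L}$ is a modal logic evaluated at points of extensions of Kripke models; pointed models $\langle\mathcal{M},w\rangle$ form $\mathrm{Pmods}(\mathfrak{L})$. $\mathsf{Tf}_x$ maps $\mathfrak{L}$-formulas to first-order formulas (countable signature) with at most the free variable $x$; $\mathsf{T}$ is a bijection from $\mathrm{Pmods}(\mathfrak{L})$ onto a class of pointed first-order models $\langle\mathcal{M}^f,g\rangle$, $g:\{x\}\to|\mathcal{M}^f|$; truth-preserving means $\mathcal{M},w\models\varphi$ iff $\mathsf{T}(\mathcal{M},w)\models\mathsf{Tf}_x(\varphi)$. An $\mathfrak{L}$-model $\mathcal{M}$ is $\omega$-saturated iff the first-order model underlying $\mathsf{T}(\mathcal{M},w)$ is $\omega$-saturated: for every finite set $A$ of its elements, every set of first-order formulas in one free variable with constants for elements of $A$ that is finitely realized in the model is realized. -}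

module Defs where

open import Data.Nat using (ℕ; zero; suc)
open import Data.Fin using (Fin; zero; suc)
open import Data.Vec using (Vec; []; _∷_; lookup)
open import Data.List using (List)
open import Data.List.Relation.Unary.All using (All)
open import Data.Sum using (_⊎_; inj₁; inj₂; [_,_])
open import Data.Product using (Σ; _×_; _,_; ∃)
open import Data.Empty using (⊥)
open import Data.Unit using (⊤)
open import Function using (const; _∘_)
open import Function.Definitions using (Injective)
open import Relation.Nullary using (¬_)
open import Relation.Binary.PropositionalEquality using (_≡_)

record Signature : Set₁ where
  field
    FunSym   : Set
    funArity : FunSym → ℕ
    RelSym   : Set
    relArity : RelSym → ℕ
open Signature public

Countable : Signature → Set
Countable S = (Σ (FunSym S → ℕ) (Injective _≡_ _≡_)) × (Σ (RelSym S → ℕ) (Injective _≡_ _≡_))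

data Term (S : Signature) (n : ℕ) : Set where
  var : Fin n → Term S n
  app : (f : FunSym S) → Vec (Term S n) (funArity S f) → Term S n

data Formula (S : Signature) : ℕ → Set where
  ⊥'   : ∀ {n} → Formula S n
  ⊤'   : ∀ {n} → Formula S n
  _≐_  : ∀ {n} → Term S n → Term S n → Formula S n
  rel  : ∀ {n} (R : RelSym S) → Vec (Term S n) (relArity S R) → Formula S n
  ¬'_  : ∀ {n} → Formula S n → Formula S n
  _∧'_ : ∀ {n} → Formula S n → Formula S n → Formula S n
  _∨'_ : ∀ {n} → Formula S n → Formula S n → Formula S n
  _⇒'_ : ∀ {n} → Formula S n → Formula S n → Formula S n
  ∀'   : ∀ {n} → Formula S (suc n) → Formula S n
  ∃'   : ∀ {n} → Formula S (suc n) → Formula S n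

record Structure (S : Signature) (D : Set) : Set₁ where
  field
    funI : (f : FunSym S) → Vec D (funArity S f) → D
    relI : (R : RelSym S) → Vec D (relArity S R) → Set
open Structure public

module _ {S : Signature} {D : Set} (𝔐 : Structure S D) where
  mutual
    evalT : ∀ {n} → (Fin n → D) → Term S n → D
    evalT ρ (var i)    = ρ i
    evalT ρ (app f ts) = funI 𝔐 f (evalTs ρ ts)

    evalTs : ∀ {n k} → (Fin n → D) → Vec (Term S n) k → Vec D k
    evalTs ρ []       = []
    evalTs ρ (t ∷ ts) = evalT ρ t ∷ evalTs ρ ts

  extend : ∀ {n} → (Fin n → D) → D → Fin (suc n) → D
  extend ρ d zero    = d
  extend ρ d (suc i) = ρ i

  Sat : ∀ {n} → (Fin n → D) → Formula S n → Set
  Sat ρ ⊥'         = ⊥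
  Sat ρ ⊤'         = ⊤
  Sat ρ (t ≐ u)    = evalT ρ t ≡ evalT ρ u
  Sat ρ (rel R ts) = relI 𝔐 R (evalTs ρ ts)
  Sat ρ (¬' φ)     = ¬ Sat ρ φ
  Sat ρ (φ ∧' ψ)   = Sat ρ φ × Sat ρ ψ
  Sat ρ (φ ∨' ψ)   = Sat ρ φ ⊎ Sat ρ ψ
  Sat ρ (φ ⇒' ψ)   = Sat ρ φ → Sat ρ ψ
  Sat ρ (∀' φ)     = (d : D) → Sat (extend ρ d) φ
  Sat ρ (∃' φ)     = Σ D λ d → Sat (extend ρ d) φ

only : ∀ {D : Set} → D → Fin 1 → D
only d _ = d

_+C_ : Signature → ℕ → Signature
FunSym   (S +C k) = FunSym S ⊎ Fin k
funArity (S +C k) = [ funArity S , const 0 ]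
RelSym   (S +C k) = RelSym S
relArity (S +C k) = relArity S

expand : ∀ {S D k} → Structure S D → Vec D k → Structure (S +C k) D
funI (expand 𝔐 A) (inj₁ f) ds = funI 𝔐 f ds
funI (expand 𝔐 A) (inj₂ i) _  = lookup A i
relI (expand 𝔐 A) = relI 𝔐

ωSaturated : ∀ {S D} → Structure S D → Set₁
ωSaturated {S} {D} 𝔐 =
  (k : ℕ) (A : Vec D k) (Γ : Formula (S +C k) 1 → Set) →
  ((Δ : List (Formula (S +C k) 1)) → All Γ Δ →
     Σ D λ d → All (Sat (expand 𝔐 A) (only d)) Δ) →
  Σ D λ d → (φ : Formula (S +C k) 1) → Γ φ → Sat (expand 𝔐 A) (only d) φ

-- Pointed first-order models ⟨𝔐ᶠ, g⟩ with g : {x} → |𝔐ᶠ| (given by g(x)).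
PointedFO : Signature → Set₁
PointedFO S = Σ Set λ D → Structure S D × D

_⊨FO_ : ∀ {S} → PointedFO S → Formula S 1 → Set
(D , 𝔐 , d) ⊨FO φ = Sat 𝔐 (only d) φ

record ModalLogic : Set₂ where
  field
    Form  : Set
    Model : Set₁
    World : Model → Set
    Acc   : (M : Model) → World M → World M → Set
    ⟨_,_⟩⊨_ : (M : Model) → World M → Form → Set

  Pmods : Set₁
  Pmods = Σ Model World

record TruthPreservingPair (𝔏 : ModalLogic) (S : Signature) : Set₂ where
  open ModalLogic 𝔏
  field
    Tf : Form → Formula S 1
    T  : Pmods → PointedFO S
    -- T is a bijection onto its image class of pointed FO models
    T-injective : ∀ {p q} → T p ≡ T q → p ≡ q
    truth-preserving : (M : Model) (w : World M) (φ : Form) →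
      (⟨ M , w ⟩⊨ φ → T (M , w) ⊨FO Tf φ) × (T (M , w) ⊨FO Tf φ → ⟨ M , w ⟩⊨ φ)

  underlying : Pmods → Σ Set (Structure S)
  underlying p = Data.Product.proj₁ (T p) , Data.Product.proj₁ (Data.Product.proj₂ (T p))
    where import Data.Product

  ωSaturatedModel : Model → Set₁
  ωSaturatedModel M = (w : World M) → ωSaturated (Data.Product.proj₂ (underlying (M , w)))
    where import Data.Product

-- The proof moves the question into first-order logic and uses saturation
-- with the single parameter w.
-- The theorem is then relativised saturation with parameter w, θ = R(c₀, x)
-- and the family Tf(Σ), transported back along the truth-preserving T.

module Submission where

open import Defs
open import Data.Nat using (ℕ)
open import Data.Fin using (Fin; zero)
open import Data.Vec using (Vec; []; _∷_)
open import Data.List using (List; []; _∷_)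
open import Data.List.Relation.Unary.All using (All; []; _∷_)
import Data.List.Relation.Unary.All as All
open import Data.Product using (Σ; _×_; _,_; proj₁; proj₂)
open import Data.Sum using (_⊎_; inj₁; inj₂)
open import Function using (id)
open import Relation.Binary.PropositionalEquality using (_≡_; refl; subst; sym; cong; cong₂; trans)

module ConstantExpansion {S : Signature} {D : Set} (𝔐 : Structure S D)
                         {k : ℕ} (A : Vec D k) where

  mutual
    embedTerm : ∀ {n} → Term S n → Term (S +C k) n
    embedTerm (var i)    = var i
    embedTerm (app f ts) = app (inj₁ f) (embedTerms ts)

    embedTerms : ∀ {n m} → Vec (Term S n) m → Vec (Term (S +C k) n) m
    embedTerms []       = []
    embedTerms (t ∷ ts) = embedTerm t ∷ embedTerms ts

  embed : ∀ {n} → Formula S n → Formula (S +C k) n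
  embed ⊥'         = ⊥'
  embed ⊤'         = ⊤'
  embed (t ≐ u)    = embedTerm t ≐ embedTerm u
  embed (rel R ts) = rel R (embedTerms ts)
  embed (¬' φ)     = ¬' embed φ
  embed (φ ∧' ψ)   = embed φ ∧' embed ψ
  embed (φ ∨' ψ)   = embed φ ∨' embed ψ
  embed (φ ⇒' ψ)   = embed φ ⇒' embed ψ
  embed (∀' φ)     = ∀' (embed φ)
  embed (∃' φ)     = ∃' (embed φ)

  mutual
    evalT-embed : ∀ {n} (ρ : Fin n → D) (t : Term S n) →
      evalT (expand 𝔐 A) ρ (embedTerm t) ≡ evalT 𝔐 ρ t
    evalT-embed ρ (var i)    = refl
    evalT-embed ρ (app f ts) = cong (funI 𝔐 f) (evalTs-embed ρ ts)

    evalTs-embed : ∀ {n m} (ρ : Fin n → D) (ts : Vec (Term S n) m) →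
      evalTs (expand 𝔐 A) ρ (embedTerms ts) ≡ evalTs 𝔐 ρ ts
    evalTs-embed ρ []       = refl
    evalTs-embed ρ (t ∷ ts) = cong₂ _∷_ (evalT-embed ρ t) (evalTs-embed ρ ts)

  -- Conservativity, both directions at once (negation and implication flip
  -- the direction, so the two halves are mutually recursive).
  mutual
    embed⁺ : ∀ {n} (ρ : Fin n → D) (φ : Formula S n) →
      Sat 𝔐 ρ φ → Sat (expand 𝔐 A) ρ (embed φ)
    embed⁺ ρ ⊥'         ()
    embed⁺ ρ ⊤'         s        = s
    embed⁺ ρ (t ≐ u)    s        = trans (evalT-embed ρ t) (trans s (sym (evalT-embed ρ u)))
    embed⁺ ρ (rel R ts) s        = subst (relI 𝔐 R) (sym (evalTs-embed ρ ts)) s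
    embed⁺ ρ (¬' φ)     s x      = s (embed⁻ ρ φ x)
    embed⁺ ρ (φ ∧' ψ)   (a , b)  = embed⁺ ρ φ a , embed⁺ ρ ψ b
    embed⁺ ρ (φ ∨' ψ)   (inj₁ a) = inj₁ (embed⁺ ρ φ a)
    embed⁺ ρ (φ ∨' ψ)   (inj₂ b) = inj₂ (embed⁺ ρ ψ b)
    embed⁺ ρ (φ ⇒' ψ)   s x      = embed⁺ ρ ψ (s (embed⁻ ρ φ x))
    embed⁺ ρ (∀' φ)     s d      = embed⁺ (extend 𝔐 ρ d) φ (s d)
    embed⁺ ρ (∃' φ)     (d , s)  = d , embed⁺ (extend 𝔐 ρ d) φ s

    embed⁻ : ∀ {n} (ρ : Fin n → D) (φ : Formula S n) →
      Sat (expand 𝔐 A) ρ (embed φ) → Sat 𝔐 ρ φ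
    embed⁻ ρ ⊥'         ()
    embed⁻ ρ ⊤'         s        = s
    embed⁻ ρ (t ≐ u)    s        = trans (sym (evalT-embed ρ t)) (trans s (evalT-embed ρ u))
    embed⁻ ρ (rel R ts) s        = subst (relI 𝔐 R) (evalTs-embed ρ ts) s
    embed⁻ ρ (¬' φ)     s x      = s (embed⁺ ρ φ x)
    embed⁻ ρ (φ ∧' ψ)   (a , b)  = embed⁻ ρ φ a , embed⁻ ρ ψ b
    embed⁻ ρ (φ ∨' ψ)   (inj₁ a) = inj₁ (embed⁻ ρ φ a)
    embed⁻ ρ (φ ∨' ψ)   (inj₂ b) = inj₂ (embed⁻ ρ ψ b)
    embed⁻ ρ (φ ⇒' ψ)   s x      = embed⁻ ρ ψ (s (embed⁺ ρ φ x))
    embed⁻ ρ (∀' φ)     s d      = embed⁻ (extend 𝔐 ρ d) φ (s d)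
    embed⁻ ρ (∃' φ)     (d , s)  = d , embed⁻ (extend 𝔐 ρ d) φ s

-- If a family f of one-variable S-formulas, indexed
-- by the I-points satisfying Γ, is finitely realised inside the set defined
-- (with parameters A) by θ, then it is realised there by a single element.
-- ω-saturation is applied to the type {θ} ∪ {embed (f i) | Γ i}.
relativisedSaturation :
  ∀ {S D} (𝔐 : Structure S D) → ωSaturated 𝔐 →
  ∀ {k} (A : Vec D k) (θ : Formula (S +C k) 1)
  {I : Set} (f : I → Formula S 1) (Γ : I → Set) →
  ((Δ : List I) → All Γ Δ →
     Σ D λ d → Sat (expand 𝔐 A) (only d) θ × All (λ i → Sat 𝔐 (only d) (f i)) Δ) →
  Σ D λ d → Sat (expand 𝔐 A) (only d) θ × ((i : I) → Γ i → Sat 𝔐 (only d) (f i))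
relativisedSaturation {S} {D} 𝔐 saturated {k} A θ {I} f Γ finitelyRealised =
  d , realised (inj₁ refl) , λ i γ → embed⁻ (only d) (f i) (realised (inj₂ (i , γ , refl)))
  where
  open ConstantExpansion 𝔐 A

  type : Formula (S +C k) 1 → Set
  type ψ = (ψ ≡ θ) ⊎ Σ I λ i → Γ i × (ψ ≡ embed (f i))

  indices : ∀ {Δ} → All type Δ → List I
  indices []                  = []
  indices (inj₁ _ ∷ ps)       = indices ps
  indices (inj₂ (i , _) ∷ ps) = i ∷ indices ps

  indices-in-Γ : ∀ {Δ} (ps : All type Δ) → All Γ (indices ps)
  indices-in-Γ []                      = []
  indices-in-Γ (inj₁ _ ∷ ps)           = indices-in-Γ ps
  indices-in-Γ (inj₂ (_ , γ , _) ∷ ps) = γ ∷ indices-in-Γ ps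

  realisesPart : ∀ e → Sat (expand 𝔐 A) (only e) θ → ∀ {Δ} (ps : All type Δ) →
    All (λ i → Sat 𝔐 (only e) (f i)) (indices ps) → All (Sat (expand 𝔐 A) (only e)) Δ
  realisesPart e inθ []                           _        = []
  realisesPart e inθ (inj₁ refl ∷ ps)             hs       = inθ ∷ realisesPart e inθ ps hs
  realisesPart e inθ (inj₂ (i , _ , refl) ∷ ps) (h ∷ hs) =
    embed⁺ (only e) (f i) h ∷ realisesPart e inθ ps hs

  typeFinitelyRealised : (Δ : List (Formula (S +C k) 1)) → All type Δ →
    Σ D λ e → All (Sat (expand 𝔐 A) (only e)) Δ
  typeFinitelyRealised Δ ps with finitelyRealised (indices ps) (indices-in-Γ ps)
  ... | e , inθ , hs = e , realisesPart e inθ ps hs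

  d : D
  d = proj₁ (saturated k A type typeFinitelyRealised)

  realised : ∀ {ψ} → type ψ → Sat (expand 𝔐 A) (only d) ψ
  realised = proj₂ (saturated k A type typeFinitelyRealised) _

evalTs-subst : ∀ {S D} (𝔑 : Structure S D) {n m m'} (eq : m ≡ m')
  (ρ : Fin n → D) (ts : Vec (Term S n) m) →
  evalTs 𝔑 ρ (subst (Vec (Term S n)) eq ts) ≡ subst (Vec D) eq (evalTs 𝔑 ρ ts)
evalTs-subst 𝔑 refl ρ ts = refl

binaryAtom : ∀ {S n} (r : RelSym S) → relArity S r ≡ 2 → Term S n → Term S n → Formula S n
binaryAtom {S} {n} r ar t u = rel r (subst (Vec (Term S n)) (sym ar) (t ∷ u ∷ []))

binaryAtom-sat : ∀ {S D} (𝔑 : Structure S D) {n} (r : RelSym S) (ar : relArity S r ≡ 2)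
  (ρ : Fin n → D) (t u : Term S n) →
  Sat 𝔑 ρ (binaryAtom r ar t u) ≡
  relI 𝔑 r (subst (Vec D) (sym ar) (evalT 𝔑 ρ t ∷ evalT 𝔑 ρ u ∷ []))
binaryAtom-sat 𝔑 r ar ρ t u = cong (relI 𝔑 r) (evalTs-subst 𝔑 (sym ar) ρ (t ∷ u ∷ []))

lemma5p2 : (𝔏 : ModalLogic) (S : Signature) → Countable S →
    (P : TruthPreservingPair 𝔏 S) →
    let open ModalLogic 𝔏
        open TruthPreservingPair P
    in (M : Model) → ωSaturatedModel M →
       (𝔐 : Structure S (World M)) →
       ((w : World M) → T (M , w) ≡ (World M , 𝔐 , w)) →
       (r : RelSym S) (ar : relArity S r ≡ 2) →
       ((a b : World M) →
          (relI 𝔐 r (subst (Vec (World M)) (sym ar) (a ∷ b ∷ [])) → Acc M a b)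
          × (Acc M a b → relI 𝔐 r (subst (Vec (World M)) (sym ar) (a ∷ b ∷ [])))) →
       (Σ' : Form → Set) (w : World M) →
       ((Δ : List Form) → All Σ' Δ →
          Σ (World M) λ v → Acc M w v × All (⟨ M , v ⟩⊨_) Δ) →
       Σ (World M) λ v → Acc M w v × ((φ : Form) → Σ' φ → ⟨ M , v ⟩⊨ φ)
lemma5p2 𝔏 S _ P M saturated 𝔐 T≡𝔐 r ar R⇔Acc Σ' w finitelySatisfiable =
  v , successorOfW⁻ v inSuccessor , λ φ inΣ → FO⇒modal v φ (realisesTf φ inΣ)
  where
  open ModalLogic 𝔏
  open TruthPreservingPair P

  𝔐-saturated : ωSaturated 𝔐
  𝔐-saturated = subst (λ (p : PointedFO S) → ωSaturated (proj₁ (proj₂ p))) (T≡𝔐 w) (saturated w)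

  𝔐w : Structure (S +C 1) (World M)
  𝔐w = expand 𝔐 (w ∷ [])

  successorOfW : Formula (S +C 1) 1
  successorOfW = binaryAtom r ar (app (inj₂ zero) []) (var zero)

  successorOfW⁺ : ∀ v → Acc M w v → Sat 𝔐w (only v) successorOfW
  successorOfW⁺ v wRv = subst id (sym (binaryAtom-sat 𝔐w r ar (only v) _ _)) (proj₂ (R⇔Acc w v) wRv)

  successorOfW⁻ : ∀ v → Sat 𝔐w (only v) successorOfW → Acc M w v
  successorOfW⁻ v s = proj₁ (R⇔Acc w v) (subst id (binaryAtom-sat 𝔐w r ar (only v) _ _) s)

  modal⇒FO : ∀ v φ → ⟨ M , v ⟩⊨ φ → Sat 𝔐 (only v) (Tf φ)
  modal⇒FO v φ h = subst (_⊨FO Tf φ) (T≡𝔐 v) (proj₁ (truth-preserving M v φ) h)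

  FO⇒modal : ∀ v φ → Sat 𝔐 (only v) (Tf φ) → ⟨ M , v ⟩⊨ φ
  FO⇒modal v φ h = proj₂ (truth-preserving M v φ) (subst (_⊨FO Tf φ) (sym (T≡𝔐 v)) h)

  finitelyRealised : (Δ : List Form) → All Σ' Δ →
    Σ (World M) λ v → Sat 𝔐w (only v) successorOfW × All (λ φ → Sat 𝔐 (only v) (Tf φ)) Δ
  finitelyRealised Δ inΣ with finitelySatisfiable Δ inΣ
  ... | v , wRv , sat = v , successorOfW⁺ v wRv , All.map (modal⇒FO v _) sat

  realisation : Σ (World M) λ v →
    Sat 𝔐w (only v) successorOfW × ((φ : Form) → Σ' φ → Sat 𝔐 (only v) (Tf φ))
  realisation = relativisedSaturation 𝔐 𝔐-saturated (w ∷ []) successorOfW Tf Σ' finitelyRealised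

  v : World M
  v = proj₁ realisation

  inSuccessor : Sat 𝔐w (only v) successorOfW
  inSuccessor = proj₁ (proj₂ realisation)

  realisesTf : (φ : Form) → Σ' φ → Sat 𝔐 (only v) (Tf φ)
  realisesTf = proj₂ (proj₂ realisation)
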